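{- Let $G$ be a connected graph with at least two vertices. Then there exists on $G$ an arithmetical structure $(M,R)$ whose associated group $\Phi_M$ is trivial.
   Context: Graphs have no self-loops but may have multiple edges. For $G$ with vertices $v_1,\dots,v_n$, $A_G$ is the adjacency matrix ($(i,j)$ entry = number of edges between $v_i,v_j$) and $M_G(a_1,\dots,a_n)=\mathrm{Diag}(a_1,\dots,a_n)-A_G$. An arithmetical structure on $G$ is a pair $(M,R)$ with $M=M_G(a_1,\dots,a_n)$ for some integers $a_1,\dots,a_n\ge1$ and $R$ a column vector of positive integers whose entries have $\gcd$ $1$, such that $MR=0$. Its associated group $\Phi_M$ is the torsion subgroup of $\mathbb{Z}^n/\mathrm{Im}(M)$. -}

module Defs where

open import Data.Nat using (ℕ; zero; suc; _<_; _≤_)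
open import Data.Nat.GCD using (gcd)
open import Data.Integer using (ℤ; +_; _+_; _-_; _*_; 0ℤ)
open import Data.Fin using (Fin; zero; suc)
open import Data.Fin.Properties using () renaming (_≟_ to _≟ᶠ_)
open import Data.Product using (Σ; ∃; _×_)
open import Relation.Nullary using (yes; no; ¬_)
open import Relation.Binary.PropositionalEquality using (_≡_)

-- A graph on vertices v_1..v_n (here Fin n): multiple edges allowed, no self-loops.
-- adj i j = number of edges between v_i and v_j (the adjacency matrix A_G).
record Multigraph (n : ℕ) : Set where
  field
    adj      : Fin n → Fin n → ℕ
    symm     : ∀ i j → adj i j ≡ adj j i
    loopless : ∀ i → adj i i ≡ 0
open Multigraph public

data Walk {n : ℕ} (G : Multigraph n) : Fin n → Fin n → Set where
  here : ∀ {i} → Walk G i i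
  step : ∀ {i j k} → 0 < adj G i j → Walk G j k → Walk G i k

Connected : ∀ {n} → Multigraph n → Set
Connected G = ∀ i j → Walk G i j

Matrix : ℕ → Set
Matrix n = Fin n → Fin n → ℤ

sumFin : ∀ {n} → (Fin n → ℤ) → ℤ
sumFin {zero}  f = 0ℤ
sumFin {suc n} f = f zero + sumFin (λ i → f (suc i))

mulVec : ∀ {n} → Matrix n → (Fin n → ℤ) → Fin n → ℤ
mulVec M x i = sumFin (λ j → M i j * x j)

Diag : ∀ {n} → (Fin n → ℕ) → Matrix n
Diag a i j with i ≟ᶠ j
... | yes _ = + a i
... | no  _ = 0ℤ

MG : ∀ {n} → Multigraph n → (Fin n → ℕ) → Matrix n
MG G a i j = Diag a i j - + adj G i j

gcdAll : ∀ {n} → (Fin n → ℕ) → ℕ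
gcdAll {zero}  f = 0
gcdAll {suc n} f = gcd (f zero) (gcdAll (λ i → f (suc i)))

record IsArithmeticalStructure {n : ℕ} (G : Multigraph n) (a R : Fin n → ℕ) : Set where
  field
    a-pos   : ∀ i → 1 ≤ a i
    R-pos   : ∀ i → 0 < R i
    R-gcd   : gcdAll R ≡ 1
    MR≡0    : ∀ i → mulVec (MG G a) (λ j → + R j) i ≡ 0ℤ

InImage : ∀ {n} → Matrix n → (Fin n → ℤ) → Set
InImage M x = ∃ λ y → ∀ i → mulVec M y i ≡ x i

-- Φ_M (torsion subgroup of ℤ^n / Im M) is trivial: every class [x] with
-- k·[x] = 0 for some nonzero integer k is already 0.
PhiTrivial : ∀ {n} → Matrix n → Set
PhiTrivial M = ∀ x → (Σ ℤ λ k → ¬ (k ≡ 0ℤ) × InImage M (λ i → k * x i)) → InImage M x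

{-# OPTIONS --safe #-}
module Submission where

-- Induct on the number of vertices. Let bⱼ be the number of edges between 0 and j.
-- Deleting vertex 0 and joining each pair j, k by bⱼbₖ further edges gives a graph G′;
-- from a structure (a, R) on G′ set a₀ = 1, aⱼ ↦ aⱼ + bⱼ² and R₀ = Σ bⱼRⱼ. Pivoting on
-- the entry a₀ = 1 turns M_G into M_G′, so M R = 0 and Im M = Rᗮ carry over, and the
-- latter makes ℤⁿ/Im M ≅ ℤ torsion free. The induction starts from one vertex with a = 0,
-- R = 1; that a ≥ 1 once n ≥ 2 follows from M R = 0, R > 0 and every vertex having a
-- neighbour.

open import Defs
open import Data.Nat using (ℕ; zero; suc; _≤_; _<_; s≤s; z≤n)
import Data.Nat as ℕ
import Data.Nat.Properties as ℕₚ
open import Data.Nat.GCD using (gcd; gcd-zeroʳ)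
open import Data.Integer using (ℤ; +_; _+_; _-_; _*_; 0ℤ; -1ℤ)
import Data.Integer.Properties as ℤ
open import Data.Integer.Tactic.RingSolver using (solve-∀)
open import Data.Fin using (Fin; zero; suc; punchIn)
open import Data.Fin.Properties using (punchInᵢ≢i; suc-injective) renaming (_≟_ to _≟ᶠ_)
open import Data.Vec.Functional using (Vector; tail)
open import Data.Product using (Σ; ∃; ∃₂; _×_; _,_)
open import Data.Sum using (inj₁; inj₂)
open import Data.Empty using (⊥-elim)
open import Function using (_∘_)
open import Relation.Nullary using (Dec; yes; no; ¬_)
open import Relation.Binary.PropositionalEquality
open import Algebra.Properties.Semiring.Sum ℤ.+-*-semiring
  using (sum; sum-cong-≗; sum-replicate-zero; ∑-distrib-+; ∑-comm; *-distribˡ-sum)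
open import Algebra.Properties.Semiring.Sum ℕₚ.+-*-semiring
  using () renaming (sum to sumℕ)

sumFin≡sum : ∀ {n} (f : Fin n → ℤ) → sumFin f ≡ sum f
sumFin≡sum {zero}  f = refl
sumFin≡sum {suc n} f = cong (_+_ (f zero)) (sumFin≡sum (tail f))

sum-zero : ∀ {n} {f : Fin n → ℤ} → (∀ i → f i ≡ 0ℤ) → sum f ≡ 0ℤ
sum-zero {n} f≗0 = trans (sum-cong-≗ f≗0) (sum-replicate-zero n)

+-sumℕ : ∀ {n} (f : Fin n → ℕ) → + sumℕ f ≡ sum (+_ ∘ f)
+-sumℕ {zero}  f = refl
+-sumℕ {suc n} f = trans (ℤ.pos-+ (f zero) _) (cong (_+_ (+ f zero)) (+-sumℕ (tail f)))

sumℕ-≥ : ∀ {n} (f : Fin n → ℕ) i → f i ≤ sumℕ f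
sumℕ-≥ f zero    = ℕₚ.m≤m+n _ _
sumℕ-≥ f (suc i) = ℕₚ.≤-trans (sumℕ-≥ (tail f) i) (ℕₚ.m≤n+m _ (f zero))

infix 7 _·_
_·_ : ∀ {n} → Vector ℤ n → Vector ℤ n → ℤ
u · v = sum (λ i → u i * v i)

·-comm : ∀ {n} (u v : Vector ℤ n) → u · v ≡ v · u
·-comm u v = sum-cong-≗ (λ i → ℤ.*-comm (u i) (v i))

·-*ˡ : ∀ {n} (c : ℤ) (u v : Vector ℤ n) → u · (λ i → c * v i) ≡ c * (u · v)
·-*ˡ c u v = trans (sum-cong-≗ (λ i → commute c (u i) (v i))) (sym (*-distribˡ-sum c (λ i → u i * v i)))
  where
  commute : ∀ c x y → x * (c * y) ≡ c * (x * y)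
  commute = solve-∀

·-distribʳ-+ : ∀ {n} (u v w : Vector ℤ n) → u · (λ i → v i + w i) ≡ u · v + u · w
·-distribʳ-+ u v w = trans (sum-cong-≗ (λ i → ℤ.*-distribˡ-+ (u i) (v i) (w i))) (∑-distrib-+ (λ i → u i * v i) (λ i → u i * w i))

pos-+-* : ∀ x y z → + (x ℕ.+ y ℕ.* z) ≡ + x + + y * + z
pos-+-* x y z = trans (ℤ.pos-+ x (y ℕ.* z)) (cong (_+_ (+ x)) (ℤ.pos-* y z))

mulVec≡· : ∀ {n} (M : Matrix n) x i → mulVec M x i ≡ M i · x
mulVec≡· M x i = sumFin≡sum (λ j → M i j * x j)

Diag-diagonal : ∀ {n} (a : Fin n → ℕ) i → Diag a i i ≡ + a i
Diag-diagonal a i with i ≟ᶠ i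
... | yes _  = refl
... | no i≢i = ⊥-elim (i≢i refl)

Diag-offDiagonal : ∀ {n} (a : Fin n → ℕ) {i j} → ¬ i ≡ j → Diag a i j ≡ 0ℤ
Diag-offDiagonal a {i} {j} i≢j with i ≟ᶠ j
... | yes i≡j = ⊥-elim (i≢j i≡j)
... | no _    = refl

Diag-zeroRow : ∀ {n} (a : Fin n → ℕ) {i} → a i ≡ 0 → ∀ j → Diag a i j ≡ 0ℤ
Diag-zeroRow a {i} aᵢ≡0 j with i ≟ᶠ j
... | yes _ = cong +_ aᵢ≡0
... | no _  = refl

Symmetric : ∀ {n} → Matrix n → Set
Symmetric M = ∀ i j → M i j ≡ M j i

Diag-symmetric : ∀ {n} (a : Fin n → ℕ) → Symmetric (Diag a)
Diag-symmetric a i j with i ≟ᶠ j | j ≟ᶠ i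
... | yes refl | yes _   = refl
... | yes i≡j  | no j≢i  = ⊥-elim (j≢i (sym i≡j))
... | no i≢j   | yes j≡i = ⊥-elim (i≢j (sym j≡i))
... | no _     | no _    = refl

MG-symmetric : ∀ {n} (G : Multigraph n) a → Symmetric (MG G a)
MG-symmetric G a i j = cong₂ (λ d e → d - + e) (Diag-symmetric a i j) (symm G i j)

·-mulVec-symmetric : ∀ {n} {M : Matrix n} → Symmetric M →
  ∀ u v → u · mulVec M v ≡ v · mulVec M u
·-mulVec-symmetric {n} {M} M-sym u v = begin
  u · mulVec M v
    ≡⟨ sum-cong-≗ (λ i → trans (cong (u i *_) (mulVec≡· M v i)) (*-distribˡ-sum (u i) (λ j → M i j * v j))) ⟩
  sum (λ i → sum (λ j → u i * (M i j * v j)))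
    ≡⟨ ∑-comm (λ i j → u i * (M i j * v j)) ⟩
  sum (λ j → sum (λ i → u i * (M i j * v j)))
    ≡⟨ sum-cong-≗ (λ j → sum-cong-≗ (λ i → trans (cong (λ m → u i * (m * v j)) (M-sym i j))
                                                 (swap (u i) (M j i) (v j)))) ⟩
  sum (λ j → sum (λ i → v j * (M j i * u i)))
    ≡⟨ sum-cong-≗ (λ j → sym (trans (cong (v j *_) (mulVec≡· M u j)) (*-distribˡ-sum (v j) (λ i → M j i * u i)))) ⟩
  v · mulVec M u ∎
  where
  open ≡-Reasoning
  swap : ∀ x m y → x * (m * y) ≡ y * (m * x)
  swap = solve-∀

OrthogonalInImage : ∀ {n} → Matrix n → Vector ℤ n → Set
OrthogonalInImage M r = ∀ x → r · x ≡ 0ℤ → InImage M x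

-- Symmetry and M r = 0 give Im M ⊆ rᗮ, so Im M = rᗮ, which is saturated in ℤⁿ:
-- r · (k x) = 0 with k ≠ 0 forces r · x = 0.
PhiTrivial-fromOrthogonal : ∀ {n} {M : Matrix n} {r : Vector ℤ n} → Symmetric M →
  (∀ i → mulVec M r i ≡ 0ℤ) → OrthogonalInImage M r → PhiTrivial M
PhiTrivial-fromOrthogonal {M = M} {r} M-sym Mr≡0 r⊥⊆Im x (k , k≢0 , y , My≡kx) =
  r⊥⊆Im x r·x≡0
  where
  open ≡-Reasoning
  k·r·x≡0 : k * (r · x) ≡ 0ℤ
  k·r·x≡0 = begin
    k * (r · x)         ≡⟨ ·-*ˡ k r x ⟨
    r · (λ i → k * x i) ≡⟨ sum-cong-≗ (λ i → cong (r i *_) (My≡kx i)) ⟨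
    r · mulVec M y      ≡⟨ ·-mulVec-symmetric M-sym r y ⟩
    y · mulVec M r      ≡⟨ sum-zero (λ i → trans (cong (y i *_) (Mr≡0 i)) (ℤ.*-zeroʳ (y i))) ⟩
    0ℤ                  ∎
  r·x≡0 : r · x ≡ 0ℤ
  r·x≡0 with ℤ.i*j≡0⇒i≡0∨j≡0 k k·r·x≡0
  ... | inj₁ k≡0   = ⊥-elim (k≢0 k≡0)
  ... | inj₂ r·x≡0 = r·x≡0

-- An arithmetical structure except that a may vanish (as it must on a single vertex),
-- with Im M = Rᗮ.
record IsSaturatedStructure {n : ℕ} (G : Multigraph n) (a R : Fin n → ℕ) : Set where
  field
    R-pos   : ∀ i → 0 < R i
    R-gcd   : gcdAll R ≡ 1
    MR≡0    : ∀ i → mulVec (MG G a) (+_ ∘ R) i ≡ 0ℤ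
    Rᗮ⊆Im   : OrthogonalInImage (MG G a) (+_ ∘ R)

loop-absurd : ∀ {n} (G : Multigraph n) {i} {A : Set} → 0 < adj G i i → A
loop-absurd G {i} p = ⊥-elim (ℕₚ.<-irrefl refl (subst (0 <_) (loopless G i) p))

walk-neighbour : ∀ {n} {G : Multigraph n} {i j} → Walk G i j → ¬ i ≡ j → ∃ λ k → 0 < adj G i k
walk-neighbour here                i≢i = ⊥-elim (i≢i refl)
walk-neighbour (step {j = k} p _) _   = k , p

connected-neighbour : ∀ {m} {G : Multigraph (suc (suc m))} → Connected G →
  ∀ i → ∃ λ k → 0 < adj G i k
connected-neighbour C i = walk-neighbour (C i (punchIn i zero)) (punchInᵢ≢i i zero ∘ sym)

neg-distribˡ-* : ∀ x y → (0ℤ - x) * y ≡ -1ℤ * (x * y)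
neg-distribˡ-* = solve-∀

-- If aᵢ = 0, row i of M R is -Σⱼ adj i j · Rⱼ, which is negative as soon as i has a neighbour.
a-pos-fromKernel : ∀ {n} (G : Multigraph n) (a R : Fin n → ℕ) → (∀ i → ∃ λ k → 0 < adj G i k) →
  (∀ i → 0 < R i) → (∀ i → mulVec (MG G a) (+_ ∘ R) i ≡ 0ℤ) → ∀ i → 1 ≤ a i
a-pos-fromKernel G a R neighbour R-pos MR≡0 i with a i in aᵢ≡
... | suc _ = s≤s z≤n
... | zero with neighbour i
...   | k , adj>0 = ⊥-elim (ℕₚ.<-irrefl refl (ℕₚ.≤-trans weight>0 (ℕₚ.≤-reflexive weight≡0)))
  where
  weights : Fin _ → ℕ
  weights j = adj G i j ℕ.* R j
  weight>0 : 0 < sumℕ weights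
  weight>0 = ℕₚ.≤-trans (ℕₚ.*-mono-≤ adj>0 (R-pos k)) (sumℕ-≥ weights k)
  row : ∀ j → MG G a i j * + R j ≡ -1ℤ * + weights j
  row j = begin
    (Diag a i j - + adj G i j) * + R j  ≡⟨ cong (λ d → (d - + adj G i j) * + R j) (Diag-zeroRow a aᵢ≡ j) ⟩
    (0ℤ - + adj G i j) * + R j          ≡⟨ neg-distribˡ-* (+ adj G i j) (+ R j) ⟩
    -1ℤ * (+ adj G i j * + R j)         ≡⟨ cong (-1ℤ *_) (ℤ.pos-* (adj G i j) (R j)) ⟨
    -1ℤ * + weights j                   ∎
    where open ≡-Reasoning
  -weight≡0 : -1ℤ * + sumℕ weights ≡ 0ℤ
  -weight≡0 = begin
    -1ℤ * + sumℕ weights           ≡⟨ cong (-1ℤ *_) (+-sumℕ weights) ⟩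
    -1ℤ * sum (+_ ∘ weights)       ≡⟨ *-distribˡ-sum -1ℤ (+_ ∘ weights) ⟩
    sum (λ j → -1ℤ * + weights j)  ≡⟨ sum-cong-≗ row ⟨
    MG G a i · (+_ ∘ R)            ≡⟨ trans (sym (mulVec≡· (MG G a) (+_ ∘ R) i)) (MR≡0 i) ⟩
    0ℤ                             ∎
    where open ≡-Reasoning
  weight≡0 : sumℕ weights ≡ 0
  weight≡0 with ℤ.i*j≡0⇒i≡0∨j≡0 -1ℤ -weight≡0
  ... | inj₂ eq = ℤ.+-injective eq

-- Pivoting on the entry a₀ = 1 of M_G(liftA a) leaves the Schur complement M_reduced(a).
module Elimination {N : ℕ} (G : Multigraph (suc N)) where

  b : Fin N → ℕ
  b j = adj G zero (suc j)

  b⃗ : Vector ℤ N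
  b⃗ = +_ ∘ b

  reducedAdj : Fin N → Fin N → ℕ
  reducedAdj j k with j ≟ᶠ k
  ... | yes _ = 0
  ... | no _  = adj G (suc j) (suc k) ℕ.+ b j ℕ.* b k

  reducedAdj-offDiagonal : ∀ {j k} → ¬ j ≡ k → reducedAdj j k ≡ adj G (suc j) (suc k) ℕ.+ b j ℕ.* b k
  reducedAdj-offDiagonal {j} {k} j≢k with j ≟ᶠ k
  ... | yes j≡k = ⊥-elim (j≢k j≡k)
  ... | no _    = refl

  reducedAdj-symm : ∀ j k → reducedAdj j k ≡ reducedAdj k j
  reducedAdj-symm j k with j ≟ᶠ k | k ≟ᶠ j
  ... | yes _   | yes _   = refl
  ... | yes j≡k | no k≢j  = ⊥-elim (k≢j (sym j≡k))
  ... | no j≢k  | yes k≡j = ⊥-elim (j≢k (sym k≡j))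
  ... | no _    | no _    = cong₂ ℕ._+_ (symm G (suc j) (suc k)) (ℕₚ.*-comm (b j) (b k))

  reducedAdj-loopless : ∀ j → reducedAdj j j ≡ 0
  reducedAdj-loopless j with j ≟ᶠ j
  ... | yes _  = refl
  ... | no j≢j = ⊥-elim (j≢j refl)

  reduced : Multigraph N
  reduced = record { adj = reducedAdj ; symm = reducedAdj-symm ; loopless = reducedAdj-loopless }

  reduced-edge : ∀ {j k} → ¬ j ≡ k → ∀ {m} → m ≤ adj G (suc j) (suc k) ℕ.+ b j ℕ.* b k →
                 0 < m → 0 < reducedAdj j k
  reduced-edge j≢k m≤ 0<m = subst (0 <_) (sym (reducedAdj-offDiagonal j≢k)) (ℕₚ.≤-trans 0<m m≤)

  -- A walk of G between nonzero vertices either avoids 0 or passes j → 0 → k,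
  -- which is a direct edge of the reduced graph when j ≢ k.
  reduced-walk : ∀ {j k} → Walk G (suc j) (suc k) → Walk reduced j k
  reduced-walk here = here
  reduced-walk {j} (step {j = suc l} p w) with j ≟ᶠ l
  ... | yes refl = loop-absurd G p
  ... | no j≢l   = step (reduced-edge j≢l (ℕₚ.m≤m+n _ _) p) (reduced-walk w)
  reduced-walk (step {j = zero} _ (step {j = zero} q _)) = loop-absurd G q
  reduced-walk {j} (step {j = zero} p (step {j = suc l} q w)) with j ≟ᶠ l
  ... | yes refl = reduced-walk w
  ... | no j≢l   = step (reduced-edge j≢l (ℕₚ.m≤n+m _ _)
                          (ℕₚ.*-mono-≤ (subst (0 <_) (symm G (suc j) zero) p) q))
                        (reduced-walk w)

  reduced-connected : Connected G → Connected reduced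
  reduced-connected C j k = reduced-walk (C (suc j) (suc k))

  liftA : (Fin N → ℕ) → Fin (suc N) → ℕ
  liftA a zero    = 1
  liftA a (suc j) = a j ℕ.+ b j ℕ.* b j

  liftR : (Fin N → ℕ) → Fin (suc N) → ℕ
  liftR R zero    = sumℕ (λ k → b k ℕ.* R k)
  liftR R (suc j) = R j

  liftR-zero : ∀ R → + liftR R zero ≡ b⃗ · (+_ ∘ R)
  liftR-zero R = trans (+-sumℕ (λ k → b k ℕ.* R k)) (sum-cong-≗ (λ k → ℤ.pos-* (b k) (R k)))

  module _ (a : Fin N → ℕ) where

    M M′ : Matrix _
    M  = MG G (liftA a)
    M′ = MG reduced a

    M-zero-zero : M zero zero ≡ + 1
    M-zero-zero = cong₂ (λ d e → d - + e) (Diag-diagonal (liftA a) zero) (loopless G zero)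

    M-zero-suc : ∀ k → M zero (suc k) ≡ 0ℤ - + b k
    M-zero-suc k = cong (_- + b k) (Diag-offDiagonal (liftA a) {zero} {suc k} (λ ()))

    M-suc-zero : ∀ j → M (suc j) zero ≡ 0ℤ - + b j
    M-suc-zero j = cong₂ (λ d e → d - + e) (Diag-offDiagonal (liftA a) {suc j} {zero} (λ ())) (symm G (suc j) zero)

    M-suc-suc-diagonal : ∀ j → M (suc j) (suc j) ≡ M′ j j + + b j * + b j
    M-suc-suc-diagonal j = begin
      Diag (liftA a) (suc j) (suc j) - + adj G (suc j) (suc j)
        ≡⟨ cong₂ (λ d e → d - + e) (Diag-diagonal (liftA a) (suc j)) (loopless G (suc j)) ⟩
      + (a j ℕ.+ b j ℕ.* b j) - + 0
        ≡⟨ cong (_- + 0) (pos-+-* (a j) (b j) (b j)) ⟩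
      (+ a j + + b j * + b j) - 0ℤ
        ≡⟨ shift (+ a j) (+ b j * + b j) ⟩
      (+ a j - 0ℤ) + + b j * + b j
        ≡⟨ cong (_+ + b j * + b j) (cong₂ (λ d e → d - + e) (Diag-diagonal a j) (reducedAdj-loopless j)) ⟨
      M′ j j + + b j * + b j ∎
      where
      open ≡-Reasoning
      shift : ∀ x y → (x + y) - 0ℤ ≡ (x - 0ℤ) + y
      shift = solve-∀

    M-suc-suc-offDiagonal : ∀ {j k} → ¬ j ≡ k → M (suc j) (suc k) ≡ M′ j k + + b j * + b k
    M-suc-suc-offDiagonal {j} {k} j≢k = begin
      Diag (liftA a) (suc j) (suc k) - + adj G (suc j) (suc k)
        ≡⟨ cong (_- + adj G (suc j) (suc k)) (Diag-offDiagonal (liftA a) (j≢k ∘ suc-injective)) ⟩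
      0ℤ - + adj G (suc j) (suc k)
        ≡⟨ cancel (+ adj G (suc j) (suc k)) (+ b j * + b k) ⟩
      (0ℤ - (+ adj G (suc j) (suc k) + + b j * + b k)) + + b j * + b k
        ≡⟨ cong (λ e → (0ℤ - e) + + b j * + b k) (pos-+-* (adj G (suc j) (suc k)) (b j) (b k)) ⟨
      (0ℤ - + (adj G (suc j) (suc k) ℕ.+ b j ℕ.* b k)) + + b j * + b k
        ≡⟨ cong (λ e → (0ℤ - + e) + + b j * + b k) (reducedAdj-offDiagonal j≢k) ⟨
      (0ℤ - + reducedAdj j k) + + b j * + b k
        ≡⟨ cong (λ d → (d - + reducedAdj j k) + + b j * + b k) (Diag-offDiagonal a j≢k) ⟨
      M′ j k + + b j * + b k ∎
      where
      open ≡-Reasoning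
      cancel : ∀ x y → 0ℤ - x ≡ (0ℤ - (x + y)) + y
      cancel = solve-∀

    M-suc-suc : ∀ j k → M (suc j) (suc k) ≡ M′ j k + + b j * + b k
    M-suc-suc j k = byCases (j ≟ᶠ k)
      where
      byCases : Dec (j ≡ k) → M (suc j) (suc k) ≡ M′ j k + + b j * + b k
      byCases (yes refl) = M-suc-suc-diagonal j
      byCases (no j≢k)   = M-suc-suc-offDiagonal j≢k

    mulVec-zero : ∀ z → mulVec M z zero ≡ z zero - b⃗ · tail z
    mulVec-zero z = begin
      mulVec M z zero
        ≡⟨ mulVec≡· M z zero ⟩
      M zero zero * z zero + sum (λ k → M zero (suc k) * z (suc k))
        ≡⟨ cong₂ (λ d s → d * z zero + s) M-zero-zero
                 (sum-cong-≗ (λ k → trans (cong (_* z (suc k)) (M-zero-suc k)) (neg-distribˡ-* (+ b k) (z (suc k))))) ⟩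
      + 1 * z zero + sum (λ k → -1ℤ * (+ b k * z (suc k)))
        ≡⟨ cong (_+_ (+ 1 * z zero)) (*-distribˡ-sum -1ℤ (λ k → + b k * z (suc k))) ⟨
      + 1 * z zero + -1ℤ * (b⃗ · tail z)
        ≡⟨ simplify (z zero) (b⃗ · tail z) ⟩
      z zero - b⃗ · tail z ∎
      where
      open ≡-Reasoning
      simplify : ∀ x y → + 1 * x + -1ℤ * y ≡ x - y
      simplify = solve-∀

    mulVec-suc : ∀ z j → mulVec M z (suc j) ≡ mulVec M′ (tail z) j + + b j * (b⃗ · tail z - z zero)
    mulVec-suc z j = begin
      mulVec M z (suc j)
        ≡⟨ mulVec≡· M z (suc j) ⟩
      M (suc j) zero * z zero + sum (λ k → M (suc j) (suc k) * z (suc k))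
        ≡⟨ cong₂ (λ d s → d * z zero + s) (M-suc-zero j)
                 (sum-cong-≗ (λ k → trans (cong (_* z (suc k)) (M-suc-suc j k))
                                          (expand (M′ j k) (+ b j) (+ b k) (z (suc k))))) ⟩
      (0ℤ - + b j) * z zero + sum (λ k → M′ j k * z (suc k) + + b j * (+ b k * z (suc k)))
        ≡⟨ cong (_+_ ((0ℤ - + b j) * z zero)) (∑-distrib-+ (λ k → M′ j k * z (suc k)) (λ k → + b j * (+ b k * z (suc k)))) ⟩
      (0ℤ - + b j) * z zero + (M′ j · tail z + sum (λ k → + b j * (+ b k * z (suc k))))
        ≡⟨ cong₂ (λ m s → (0ℤ - + b j) * z zero + (m + s)) (mulVec≡· M′ (tail z) j)
                 (*-distribˡ-sum (+ b j) (λ k → + b k * z (suc k))) ⟨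
      (0ℤ - + b j) * z zero + (mulVec M′ (tail z) j + + b j * (b⃗ · tail z))
        ≡⟨ regroup (+ b j) (z zero) (mulVec M′ (tail z) j) (b⃗ · tail z) ⟩
      mulVec M′ (tail z) j + + b j * (b⃗ · tail z - z zero) ∎
      where
      open ≡-Reasoning
      expand : ∀ m x y w → (m + x * y) * w ≡ m * w + x * (y * w)
      expand = solve-∀
      regroup : ∀ x z₀ m s → (0ℤ - x) * z₀ + (m + x * s) ≡ m + x * (s - z₀)
      regroup = solve-∀

  saturated-lift : ∀ {a R} → (∃ λ k → 0 < b k) → IsSaturatedStructure reduced a R →
                   IsSaturatedStructure G (liftA a) (liftR R)
  saturated-lift {a} {R} (k , b>0) S = record
    { R-pos = R-pos′ ; R-gcd = R-gcd′ ; MR≡0 = MR≡0′ ; Rᗮ⊆Im = Rᗮ⊆Im′ }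
    where
    open IsSaturatedStructure S
    open ≡-Reasoning
    R⃗ R⃗′ : Vector ℤ _
    R⃗  = +_ ∘ R
    R⃗′ = +_ ∘ liftR R

    R-pos′ : ∀ i → 0 < liftR R i
    R-pos′ zero    = ℕₚ.≤-trans (ℕₚ.*-mono-≤ b>0 (R-pos k)) (sumℕ-≥ (λ l → b l ℕ.* R l) k)
    R-pos′ (suc j) = R-pos j

    R-gcd′ : gcdAll (liftR R) ≡ 1
    R-gcd′ = trans (cong (gcd (liftR R zero)) R-gcd) (gcd-zeroʳ (liftR R zero))

    MR≡0′ : ∀ i → mulVec (M a) R⃗′ i ≡ 0ℤ
    MR≡0′ zero = begin
      mulVec (M a) R⃗′ zero  ≡⟨ mulVec-zero a R⃗′ ⟩
      R⃗′ zero - b⃗ · R⃗      ≡⟨ cong (_- b⃗ · R⃗) (liftR-zero R) ⟩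
      b⃗ · R⃗ - b⃗ · R⃗        ≡⟨ ℤ.+-inverseʳ (b⃗ · R⃗) ⟩
      0ℤ                   ∎
    MR≡0′ (suc j) = begin
      mulVec (M a) R⃗′ (suc j)
        ≡⟨ mulVec-suc a R⃗′ j ⟩
      mulVec (M′ a) R⃗ j + + b j * (b⃗ · R⃗ - R⃗′ zero)
        ≡⟨ cong₂ (λ m r → m + + b j * (b⃗ · R⃗ - r)) (MR≡0 j) (liftR-zero R) ⟩
      0ℤ + + b j * (b⃗ · R⃗ - b⃗ · R⃗)
        ≡⟨ cong (λ d → 0ℤ + + b j * d) (ℤ.+-inverseʳ (b⃗ · R⃗)) ⟩
      0ℤ + + b j * 0ℤ
        ≡⟨ cong (_+_ 0ℤ) (ℤ.*-zeroʳ (+ b j)) ⟩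
      0ℤ ∎

    x′ : Vector ℤ _ → Vector ℤ _
    x′ x j = x (suc j) + x zero * + b j

    x′⊥R : ∀ x → R⃗′ · x ≡ 0ℤ → R⃗ · x′ x ≡ 0ℤ
    x′⊥R x x⊥R′ = begin
      R⃗ · x′ x                                ≡⟨ ·-distribʳ-+ R⃗ (tail x) (λ j → x zero * + b j) ⟩
      R⃗ · tail x + R⃗ · (λ j → x zero * + b j) ≡⟨ cong (_+_ (R⃗ · tail x)) (·-*ˡ (x zero) R⃗ b⃗) ⟩
      R⃗ · tail x + x zero * (R⃗ · b⃗)          ≡⟨ cong (λ s → R⃗ · tail x + x zero * s) (trans (·-comm R⃗ b⃗) (sym (liftR-zero R))) ⟩
      R⃗ · tail x + x zero * R⃗′ zero          ≡⟨ swap (R⃗ · tail x) (x zero) (R⃗′ zero) ⟩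
      R⃗′ · x                                ≡⟨ x⊥R′ ⟩
      0ℤ                                    ∎
      where
      swap : ∀ s x₀ r₀ → s + x₀ * r₀ ≡ r₀ * x₀ + s
      swap = solve-∀

    -- A preimage y′ of x′ = tail x + x₀ b under M′ extends to the preimage (x₀ + b · y′, y′) of x.
    Rᗮ⊆Im′ : OrthogonalInImage (M a) R⃗′
    Rᗮ⊆Im′ x x⊥R′ with Rᗮ⊆Im (x′ x) (x′⊥R x x⊥R′)
    ... | y′ , M′y′≡x′ = y , My≡x
      where
      y : Vector ℤ _
      y zero    = x zero + b⃗ · y′
      y (suc j) = y′ j
      My≡x : ∀ i → mulVec (M a) y i ≡ x i
      My≡x zero = trans (mulVec-zero a y) (cancel (x zero) (b⃗ · y′))
        where
        cancel : ∀ x₀ s → (x₀ + s) - s ≡ x₀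
        cancel = solve-∀
      My≡x (suc j) = begin
        mulVec (M a) y (suc j)                         ≡⟨ mulVec-suc a y j ⟩
        mulVec (M′ a) y′ j + + b j * (b⃗ · y′ - y zero) ≡⟨ cong (_+ + b j * (b⃗ · y′ - y zero)) (M′y′≡x′ j) ⟩
        x′ x j + + b j * (b⃗ · y′ - y zero)             ≡⟨ cancel (x (suc j)) (x zero) (+ b j) (b⃗ · y′) ⟩
        x (suc j)                                      ∎
        where
        cancel : ∀ xⱼ x₀ bⱼ s → (xⱼ + x₀ * bⱼ) + bⱼ * (s - (x₀ + s)) ≡ xⱼ
        cancel = solve-∀

  neighbour-of-zero : ∀ {j} → Walk G zero (suc j) → ∃ λ k → 0 < b k
  neighbour-of-zero w with walk-neighbour w (λ ())
  ... | zero  , p = loop-absurd G p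
  ... | suc k , p = k , p

saturated-singleton : (G : Multigraph 1) → IsSaturatedStructure G (λ _ → 0) (λ _ → 1)
saturated-singleton G = record
  { R-pos = λ _ → s≤s z≤n
  ; R-gcd = refl
  ; MR≡0  = λ { zero → cong (λ e → (+ 0 - + e) * + 1 + 0ℤ) (loopless G zero) }
  ; Rᗮ⊆Im = λ x x⊥1 → (λ _ → 0ℤ) , λ { zero → preimage x x⊥1 }
  }
  where
  open ≡-Reasoning
  preimage : ∀ x → (λ _ → + 1) · x ≡ 0ℤ → mulVec (MG G (λ _ → 0)) (λ _ → 0ℤ) zero ≡ x zero
  preimage x x⊥1 = begin
    MG G (λ _ → 0) zero zero * 0ℤ + 0ℤ ≡⟨ cong (_+ 0ℤ) (ℤ.*-zeroʳ (MG G (λ _ → 0) zero zero)) ⟩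
    0ℤ                                 ≡⟨ x⊥1 ⟨
    + 1 * x zero + 0ℤ                  ≡⟨ trans (ℤ.+-identityʳ _) (ℤ.*-identityˡ (x zero)) ⟩
    x zero                             ∎

saturated-exists : ∀ N (G : Multigraph (suc N)) → Connected G → ∃₂ λ a R → IsSaturatedStructure G a R
saturated-exists zero    G _ = _ , _ , saturated-singleton G
saturated-exists (suc N) G C
  with saturated-exists N (Elimination.reduced G) (Elimination.reduced-connected G C)
... | a , R , S = liftA a , liftR R , saturated-lift (neighbour-of-zero (C zero (suc zero))) S
  where open Elimination G

corollary2p10 : (n : ℕ) (G : Multigraph n) → 2 ≤ n → Connected G →
    Σ (Fin n → ℕ) λ a → Σ (Fin n → ℕ) λ R →
      IsArithmeticalStructure G a R × PhiTrivial (MG G a)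
corollary2p10 (suc zero) G (s≤s ()) C
corollary2p10 (suc (suc m)) G _ C with saturated-exists (suc m) G C
... | a , R , S = a , R , arithmetical , PhiTrivial-fromOrthogonal {r = +_ ∘ R} (MG-symmetric G a) MR≡0 Rᗮ⊆Im
  where
  open IsSaturatedStructure S
  arithmetical : IsArithmeticalStructure G a R
  arithmetical = record
    { a-pos = a-pos-fromKernel G a R (connected-neighbour C) R-pos MR≡0
    ; R-pos = R-pos
    ; R-gcd = R-gcd
    ; MR≡0  = MR≡0
    }
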